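{- Let $\mathcal{C}\subseteq\mathbb{F}_{q^m}^n$ be a Gabidulin rank-metric code of dimension $k$. Then for $1\le r\le k$, the $r$-th generalized rank weight of $\mathcal{C}$ is $$d_r=\min\{\dim_{\mathbb{F}_q}X: X\in\Sigma(\mathcal{E}),\ \eta^*_\mathcal{C}(X)\ge r\},$$ where $\eta^*_\mathcal{C}$ is the nullity function of the dual $q$-matroid of $\mathcal{M}_\mathcal{C}=(\mathcal{E},\rho_\mathcal{C})$.
   Context: $\mathcal{E}=\mathbb{F}_q^n$, $\Sigma(\mathcal{E})$ its set of subspaces. A Gabidulin code is an $\mathbb{F}_{q^m}$-linear subspace $\mathcal{C}\subseteq\mathbb{F}_{q^m}^n$. With a fixed $\mathbb{F}_q$-basis of $\mathbb{F}_{q^m}$, $c=(c_1,\dots,c_n)$ is represented by the $m\times n$ matrix over $\mathbb{F}_q$ whose $j$-th column is the coordinate vector of $c_j$; $Rsupp(c)$ is the row space of this matrix; for a subcode $D$, $Rsupp(D)$ is the $\mathbb{F}_q$-span of all $Rsupp(d)$. $d_r=\min\{\dim_{\mathbb{F}_q}Rsupp(D): D$ an $\mathbb{F}_{q^m}$-subspace of $\mathcal{C}$, $\dim D=r\}$. $\mathcal{C}(X)=\{c\in\mathcal{C}:Rsupp(c)\subseteq X\}$, $\rho_\mathcal{C}(X)=k-\dim_{\mathbb{F}_{q^m}}\mathcal{C}(X^\perp)$ ($X^\perp$ orthogonal complement for the standard dot product); this is a $q$-matroid. Its dual has rank $\rho^*_\mathcal{C}(X)=\dim X+\rho_\mathcal{C}(X^\perp)-\rho_\mathcal{C}(\mathcal{E})$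 and nullity $\eta^*_\mathcal{C}(X)=\dim X-\rho^*_\mathcal{C}(X)$. -}

module Defs where

open import Level using (0ℓ)
open import Data.Nat using (ℕ; zero; suc)
open import Data.Fin using (Fin; zero; suc)
open import Data.Vec using (Vec; lookup; tabulate)
open import Data.Product using (Σ; ∃; ∃-syntax; _×_; _,_)
open import Data.Empty using (⊥)
open import Relation.Nullary using (¬_)
open import Relation.Binary.PropositionalEquality using (_≡_)
open import Algebra.Structures using (IsCommutativeRing)
open import Data.Integer as ℤ using (ℤ; +_)

record Field : Set₁ where
  infixl 6 _+_
  infixl 7 _*_
  field
    Carrier : Set
    _+_ _*_ : Carrier → Carrier → Carrier
    -_      : Carrier → Carrier
    0# 1#   : Carrier
    isCommutativeRing : IsCommutativeRing _≡_ _+_ _*_ -_ 0# 1#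
    0≢1     : ¬ (0# ≡ 1#)
    inverse : ∀ x → ¬ (x ≡ 0#) → ∃[ y ] (x * y ≡ 1#)

module LinAlg (F : Field) where
  open Field F

  ∑ : ∀ {ℓ} → (Fin ℓ → Carrier) → Carrier
  ∑ {zero}  f = 0#
  ∑ {suc ℓ} f = f zero + ∑ (λ i → f (suc i))

  zeroV : ∀ {n} → Vec Carrier n
  zeroV = tabulate (λ _ → 0#)

  _+V_ : ∀ {n} → Vec Carrier n → Vec Carrier n → Vec Carrier n
  x +V y = tabulate (λ j → lookup x j + lookup y j)

  _·V_ : ∀ {n} → Carrier → Vec Carrier n → Vec Carrier n
  a ·V x = tabulate (λ j → a * lookup x j)

  lincomb : ∀ {ℓ n} → (Fin ℓ → Carrier) → (Fin ℓ → Vec Carrier n) → Vec Carrier n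
  lincomb a w = tabulate (λ j → ∑ (λ i → a i * lookup (w i) j))

  _·_ : ∀ {n} → Vec Carrier n → Vec Carrier n → Carrier
  x · y = ∑ (λ j → lookup x j * lookup y j)

  record IsSubspace {n} (V : Vec Carrier n → Set) : Set where
    field
      zero-mem : V zeroV
      +-mem    : ∀ x y → V x → V y → V (x +V y)
      ·-mem    : ∀ a x → V x → V (a ·V x)

  _⊆_ : ∀ {n} → (Vec Carrier n → Set) → (Vec Carrier n → Set) → Set
  U ⊆ V = ∀ x → U x → V x

  Span : ∀ {n} → (Vec Carrier n → Set) → Vec Carrier n → Set
  Span S x = ∃[ ℓ ] Σ (Fin ℓ → Carrier) λ a → Σ (Fin ℓ → Vec Carrier _) λ w →
               (∀ i → S (w i)) × (x ≡ lincomb a w)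

  LinIndep : ∀ {ℓ n} → (Fin ℓ → Vec Carrier n) → Set
  LinIndep w = ∀ a → lincomb a w ≡ zeroV → ∀ i → a i ≡ 0#

  HasDim : ∀ {n} → (Vec Carrier n → Set) → ℕ → Set
  HasDim V d = Σ (Fin d → Vec Carrier _) λ w →
                 (∀ i → V (w i)) × LinIndep w × (∀ x → V x → ∃[ a ] (x ≡ lincomb a w))

  _⊥ : ∀ {n} → (Vec Carrier n → Set) → Vec Carrier n → Set
  (X ⊥) y = ∀ x → X x → x · y ≡ 0#

  Full : ∀ {n} → Vec Carrier n → Set
  Full _ = Data.Unit.⊤
    where import Data.Unit

-- A degree-m extension K = F_{q^m} of F = F_q with a fixed F-basis β,
-- given by the embedding ι and the coordinate map coord : K → F^m.

record Extension (F K : Field) (m : ℕ) : Set where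
  private
    module F = Field F
    module K = Field K
  open LinAlg K using (∑)
  field
    ι      : F.Carrier → K.Carrier
    ι-+    : ∀ a b → ι (a F.+ b) ≡ ι a K.+ ι b
    ι-*    : ∀ a b → ι (a F.* b) ≡ ι a K.* ι b
    ι-1    : ι F.1# ≡ K.1#
    β      : Fin m → K.Carrier
    coord  : K.Carrier → Vec F.Carrier m
    coord-expand : ∀ x → ∑ (λ i → ι (lookup (coord x) i) K.* β i) ≡ x
    coord-unique : ∀ (a : Vec F.Carrier m) → coord (∑ (λ i → ι (lookup a i) K.* β i)) ≡ a

IsLeast : ∀ {a} → (ℕ → Set a) → ℕ → Set a
IsLeast P d = P d × (∀ e → P e → d Data.Nat.≤ e)
  where import Data.Nat

module GabidulinCode {F K : Field} {m : ℕ} (E : Extension F K m) {n : ℕ}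
                     (C : Vec (Field.Carrier K) n → Set) (k : ℕ) where
  private
    module F = Field F
    module K = Field K
    module LF = LinAlg F
    module LK = LinAlg K
  open Extension E

  FVec = Vec F.Carrier n
  KVec = Vec K.Carrier n

  -- j-th column of the m×n matrix of c is coord (c_j);
  -- i-th row of that matrix:
  row : KVec → Fin m → FVec
  row c i = tabulate (λ j → lookup (coord (lookup c j)) i)

  Rsupp : KVec → FVec → Set
  Rsupp c = LF.Span (λ x → ∃[ i ] (x ≡ row c i))

  RsuppSub : (KVec → Set) → FVec → Set
  RsuppSub D = LF.Span (λ x → ∃[ d ] (D d × Rsupp d x))

  -- generalized rank weights: e ∈ GRW r  iff  e = dim Rsupp(D) for some
  -- F_{q^m}-subspace D ⊆ C with dim D = r;  d_r = min GRW r
  GRW : ℕ → ℕ → Set₁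
  GRW r e = Σ (KVec → Set) λ D → LK.IsSubspace D × (D LK.⊆ C) × LK.HasDim D r
              × LF.HasDim (RsuppSub D) e

  Sub : (FVec → Set) → KVec → Set
  Sub X c = C c × (Rsupp c LF.⊆ X)

  Rank : (FVec → Set) → ℤ → Set
  Rank X ρ = ∃[ c ] (LK.HasDim (Sub (X LF.⊥)) c × ρ ≡ (+ k) ℤ.- (+ c))

  DualRank : (FVec → Set) → ℤ → Set
  DualRank X ρs = ∃[ dx ] ∃[ ρ₁ ] ∃[ ρ₂ ]
    (LF.HasDim X dx × Rank (X LF.⊥) ρ₁ × Rank LF.Full ρ₂ × ρs ≡ (+ dx) ℤ.+ ρ₁ ℤ.- ρ₂)

  DualNullity : (FVec → Set) → ℤ → Set
  DualNullity X η = ∃[ dx ] ∃[ ρs ] (LF.HasDim X dx × DualRank X ρs × η ≡ (+ dx) ℤ.- ρs)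

  NullSet : ℕ → ℕ → Set₁
  NullSet r e = Σ (FVec → Set) λ X → LF.IsSubspace X × LF.HasDim X e
                  × ∃[ η ] (DualNullity X η × (+ r) ℤ.≤ η)

-- The support Rsupp(D) of a subcode D is the span of the rows of a basis of D, and D ⊆ C(Rsupp D).
-- Unfolding the definitions, η*(X) = dim C(X^⊥⊥) − dim C({0}) = dim C(X), and an r-dimensional
-- subcode of C(X) has its support inside X. So both "e ≥ dim Rsupp(D) for some r-dimensional D" and
-- "η*(X) ≥ r for some X of dimension e" amount to: r independent codewords have all their rows in
-- the span of e vectors. Over a finite field this is decidable, hence has a least witness e₀, and
-- the subcode spanned by such codewords attains e₀ in both sets.
module Submission where

open import Defs
open import Data.Nat using (ℕ; _≤_)
open import Data.Fin using (Fin)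
open import Data.Vec using (Vec)
open import Data.Product using (∃-syntax; _×_)
open import Function.Bundles using (_↔_)

open import Algebra.Bundles using (CommutativeRing)
open import Algebra.Structures using (IsCommutativeRing)
open import Data.Empty using (⊥-elim)
open import Data.Fin using (zero; suc; _↑ʳ_)
import Data.Fin as Fin
import Data.Fin.Properties as FinP
open import Data.Integer using (ℤ)
import Data.Integer as ℤ
import Data.Integer.Properties as ℤₚ
open import Data.Integer.Tactic.RingSolver using (solve-∀)
open import Data.Nat using (zero; suc)
import Data.Nat as ℕ
import Data.Nat.Properties as ℕₚ
open import Data.Product using (Σ; ∃; _,_; proj₁; proj₂)
open import Data.Sum using (_⊎_; inj₁; inj₂; [_,_]′)
open import Data.Vec using ([]; _∷_; lookup; tabulate)
open import Data.Vec.Functional using () renaming (_∷_ to _◂_)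
import Data.Vec.Properties as VecP
open import Data.Vec.Properties using (lookup∘tabulate; tabulate∘lookup; tabulate-cong)
open import Function.Bundles using (Inverse; mk↔ₛ′)
open import Level using (0ℓ)
open import Relation.Binary.Definitions using (DecidableEquality)
open import Relation.Binary.PropositionalEquality
open import Relation.Nullary using (¬_; Dec; yes; no; ¬?; _→-dec_; _×-dec_)
import Relation.Nullary.Decidable as Dec
open import Relation.Nullary.Decidable using (decidable-stable)
import Relation.Unary as U

lookup-ext : ∀ {A : Set} {n} {x y : Vec A n} → (∀ i → lookup x i ≡ lookup y i) → x ≡ y
lookup-ext {x = x} {y} x≗y = trans (sym (tabulate∘lookup x)) (trans (tabulate-cong x≗y) (tabulate∘lookup y))

module LinAlgProperties (F : Field) where
  open Field F
  open LinAlg F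
  open IsCommutativeRing isCommutativeRing public
    using ( *-assoc; *-comm; distribˡ; distribʳ; +-identityˡ; +-identityʳ
          ; *-identityˡ; *-identityʳ; -‿inverseʳ; zeroˡ; zeroʳ)
  open ≡-Reasoning

  commutativeRing : CommutativeRing 0ℓ 0ℓ
  commutativeRing = record { isCommutativeRing = isCommutativeRing }

  open import Algebra.Properties.Ring (CommutativeRing.ring commutativeRing) public
    using (-‿distribˡ-*; -‿distribʳ-*; +-inverseˡ-unique; x∙y⁻¹≈ε⇒x≈y; x+x≈x⇒x≈0)
  open import Algebra.Properties.CommutativeSemigroup
    (CommutativeRing.*-commutativeSemigroup commutativeRing) public
    using () renaming (x∙yz≈y∙xz to *-leftComm)
  open import Algebra.Properties.Semiring.Sum (CommutativeRing.semiring commutativeRing)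
    using (sum; sum-cong-≗; sum-replicate-zero; ∑-distrib-+; ∑-comm; *-distribˡ-sum; *-distribʳ-sum)

  -- LinAlg.∑ unfolds like the library's sum, but only for a concrete length.
  ∑≡sum : ∀ {ℓ} (f : Fin ℓ → Carrier) → ∑ f ≡ sum f
  ∑≡sum {zero}  f = refl
  ∑≡sum {suc ℓ} f = cong (f zero +_) (∑≡sum (λ i → f (suc i)))

  ∑-cong : ∀ {ℓ} {f g : Fin ℓ → Carrier} → f ≗ g → ∑ f ≡ ∑ g
  ∑-cong {f = f} {g} f≗g = trans (∑≡sum f) (trans (sum-cong-≗ f≗g) (sym (∑≡sum g)))

  ∑-zero : ∀ ℓ → ∑ {ℓ} (λ _ → 0#) ≡ 0#
  ∑-zero ℓ = trans (∑≡sum {ℓ} (λ _ → 0#)) (sum-replicate-zero ℓ)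

  ∑-+ : ∀ {ℓ} (f g : Fin ℓ → Carrier) → ∑ (λ i → f i + g i) ≡ ∑ f + ∑ g
  ∑-+ f g = trans (∑≡sum (λ i → f i + g i))
    (trans (∑-distrib-+ f g) (sym (cong₂ _+_ (∑≡sum f) (∑≡sum g))))

  *-distribˡ-∑ : ∀ {ℓ} a (f : Fin ℓ → Carrier) → a * ∑ f ≡ ∑ (λ i → a * f i)
  *-distribˡ-∑ a f = trans (cong (a *_) (∑≡sum f))
    (trans (*-distribˡ-sum a f) (sym (∑≡sum (λ i → a * f i))))

  *-distribʳ-∑ : ∀ {ℓ} a (f : Fin ℓ → Carrier) → ∑ f * a ≡ ∑ (λ i → f i * a)
  *-distribʳ-∑ a f = trans (cong (_* a) (∑≡sum f))
    (trans (*-distribʳ-sum a f) (sym (∑≡sum (λ i → f i * a))))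

  ∑-swap : ∀ {ℓ ℓ′} (f : Fin ℓ → Fin ℓ′ → Carrier) →
           ∑ (λ i → ∑ (λ j → f i j)) ≡ ∑ (λ j → ∑ (λ i → f i j))
  ∑-swap f = trans (∑∑≡sumsum f) (trans (∑-comm f) (sym (∑∑≡sumsum (λ j i → f i j))))
    where
    ∑∑≡sumsum : ∀ {ℓ ℓ′} (g : Fin ℓ → Fin ℓ′ → Carrier) →
                ∑ (λ i → ∑ (g i)) ≡ sum (λ i → sum (g i))
    ∑∑≡sumsum g = trans (∑≡sum (λ i → ∑ (g i))) (sum-cong-≗ (λ i → ∑≡sum (g i)))

  δ : ∀ {ℓ} → Fin ℓ → Fin ℓ → Carrier
  δ zero    zero    = 1#
  δ zero    (suc j) = 0#
  δ (suc i) zero    = 0#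
  δ (suc i) (suc j) = δ i j

  δ-sym : ∀ {ℓ} (i j : Fin ℓ) → δ i j ≡ δ j i
  δ-sym zero    zero    = refl
  δ-sym zero    (suc j) = refl
  δ-sym (suc i) zero    = refl
  δ-sym (suc i) (suc j) = δ-sym i j

  ∑-δʳ : ∀ {ℓ} (f : Fin ℓ → Carrier) j → ∑ (λ i → f i * δ i j) ≡ f j
  ∑-δʳ {suc ℓ} f zero = begin
    f zero * 1# + ∑ (λ i → f (suc i) * 0#)
      ≡⟨ cong₂ _+_ (*-identityʳ _) (∑-cong (λ i → zeroʳ (f (suc i)))) ⟩
    f zero + ∑ {ℓ} (λ _ → 0#)  ≡⟨ cong (f zero +_) (∑-zero ℓ) ⟩
    f zero + 0#               ≡⟨ +-identityʳ _ ⟩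
    f zero                    ∎
  ∑-δʳ f (suc j) = begin
    f zero * 0# + ∑ (λ i → f (suc i) * δ i j)  ≡⟨ cong₂ _+_ (zeroʳ _) (∑-δʳ (λ i → f (suc i)) j) ⟩
    0# + f (suc j)                             ≡⟨ +-identityˡ (f (suc j)) ⟩
    f (suc j)                                  ∎

  ∑-δˡ : ∀ {ℓ} (f : Fin ℓ → Carrier) j → ∑ (λ i → δ i j * f i) ≡ f j
  ∑-δˡ f j = trans (∑-cong (λ i → *-comm (δ i j) (f i))) (∑-δʳ f j)

  lookup-lincomb : ∀ {ℓ n} (a : Fin ℓ → Carrier) (w : Fin ℓ → Vec Carrier n) j →
                   lookup (lincomb a w) j ≡ ∑ (λ i → a i * lookup (w i) j)
  lookup-lincomb a w = lookup∘tabulate _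

  lincomb-cong : ∀ {ℓ n} {a b : Fin ℓ → Carrier} (w : Fin ℓ → Vec Carrier n) → a ≗ b →
                 lincomb a w ≡ lincomb b w
  lincomb-cong w a≗b = tabulate-cong (λ j → ∑-cong (λ i → cong (_* lookup (w i) j) (a≗b i)))

  lincomb-congʳ : ∀ {ℓ n} (a : Fin ℓ → Carrier) {w v : Fin ℓ → Vec Carrier n} → w ≗ v →
                  lincomb a w ≡ lincomb a v
  lincomb-congʳ a w≗v = tabulate-cong (λ j → ∑-cong (λ i → cong (λ x → a i * lookup x j) (w≗v i)))

  lincomb-zero : ∀ {ℓ n} (w : Fin ℓ → Vec Carrier n) → lincomb (λ _ → 0#) w ≡ zeroV
  lincomb-zero {ℓ} w = tabulate-cong (λ j → trans (∑-cong (λ i → zeroˡ (lookup (w i) j))) (∑-zero ℓ))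

  lincomb-+ : ∀ {ℓ n} (a b : Fin ℓ → Carrier) (w : Fin ℓ → Vec Carrier n) →
              lincomb (λ i → a i + b i) w ≡ lincomb a w +V lincomb b w
  lincomb-+ a b w = tabulate-cong λ j → begin
    ∑ (λ i → (a i + b i) * lookup (w i) j)
      ≡⟨ ∑-cong (λ i → distribʳ _ (a i) (b i)) ⟩
    ∑ (λ i → a i * lookup (w i) j + b i * lookup (w i) j)
      ≡⟨ ∑-+ (λ i → a i * lookup (w i) j) (λ i → b i * lookup (w i) j) ⟩
    ∑ (λ i → a i * lookup (w i) j) + ∑ (λ i → b i * lookup (w i) j)
      ≡⟨ cong₂ _+_ (lookup-lincomb a w j) (lookup-lincomb b w j) ⟨
    lookup (lincomb a w) j + lookup (lincomb b w) j ∎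

  lincomb-* : ∀ {ℓ n} c (a : Fin ℓ → Carrier) (w : Fin ℓ → Vec Carrier n) →
              lincomb (λ i → c * a i) w ≡ c ·V lincomb a w
  lincomb-* c a w = tabulate-cong λ j → begin
    ∑ (λ i → (c * a i) * lookup (w i) j)  ≡⟨ ∑-cong (λ i → *-assoc c (a i) _) ⟩
    ∑ (λ i → c * (a i * lookup (w i) j))  ≡⟨ *-distribˡ-∑ c (λ i → a i * lookup (w i) j) ⟨
    c * ∑ (λ i → a i * lookup (w i) j)    ≡⟨ cong (c *_) (lookup-lincomb a w j) ⟨
    c * lookup (lincomb a w) j            ∎

  lincomb-δ : ∀ {ℓ n} (w : Fin ℓ → Vec Carrier n) k → lincomb (λ i → δ i k) w ≡ w k
  lincomb-δ w k = lookup-ext λ j →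
    trans (lookup-lincomb (λ i → δ i k) w j) (∑-δˡ (λ i → lookup (w i) j) k)

  lincomb-suc : ∀ {ℓ n} (a : Fin (suc ℓ) → Carrier) (w : Fin (suc ℓ) → Vec Carrier n) →
                lincomb a w ≡ (a zero ·V w zero) +V lincomb (λ i → a (suc i)) (λ i → w (suc i))
  lincomb-suc a w = tabulate-cong λ j → cong₂ _+_
    (sym (lookup∘tabulate (λ j → a zero * lookup (w zero) j) j))
    (sym (lookup-lincomb (λ i → a (suc i)) (λ i → w (suc i)) j))

  lincomb-headZero : ∀ {ℓ n} (a : Fin (suc ℓ) → Carrier) (w : Fin (suc ℓ) → Vec Carrier n) →
                     a zero ≡ 0# → lincomb a w ≡ lincomb (λ i → a (suc i)) (λ i → w (suc i))
  lincomb-headZero a w a₀≡0 = tabulate-cong λ j → begin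
    a zero * lookup (w zero) j + tail j  ≡⟨ cong (λ c → c * lookup (w zero) j + tail j) a₀≡0 ⟩
    0# * lookup (w zero) j + tail j      ≡⟨ cong (_+ tail j) (zeroˡ _) ⟩
    0# + tail j                          ≡⟨ +-identityˡ (tail j) ⟩
    tail j                               ∎
    where
    tail : Fin _ → Carrier
    tail j = ∑ (λ i → a (suc i) * lookup (w (suc i)) j)

  lincomb∈ : ∀ {ℓ n} {V : Vec Carrier n → Set} → IsSubspace V → (w : Fin ℓ → Vec Carrier n) →
             (∀ i → V (w i)) → ∀ a → V (lincomb a w)
  lincomb∈ {zero}  V-sub w w∈V a = IsSubspace.zero-mem V-sub
  lincomb∈ {suc ℓ} {V = V} V-sub w w∈V a = subst V (sym (lincomb-suc a w))
    (IsSubspace.+-mem V-sub _ _ (IsSubspace.·-mem V-sub (a zero) (w zero) (w∈V zero))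
      (lincomb∈ V-sub (λ i → w (suc i)) (λ i → w∈V (suc i)) (λ i → a (suc i))))

  SpanOf : ∀ {ℓ n} → (Fin ℓ → Vec Carrier n) → Vec Carrier n → Set
  SpanOf w x = ∃[ a ] (x ≡ lincomb a w)

  SpanOf-isSubspace : ∀ {ℓ n} (w : Fin ℓ → Vec Carrier n) → IsSubspace (SpanOf w)
  SpanOf-isSubspace w = record
    { zero-mem = (λ _ → 0#) , sym (lincomb-zero w)
    ; +-mem    = λ { x y (a , refl) (b , refl) → (λ i → a i + b i) , sym (lincomb-+ a b w) }
    ; ·-mem    = λ { c x (a , refl) → (λ i → c * a i) , sym (lincomb-* c a w) }
    }

  w∈SpanOf : ∀ {ℓ n} (w : Fin ℓ → Vec Carrier n) k → SpanOf w (w k)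
  w∈SpanOf w k = (λ i → δ i k) , sym (lincomb-δ w k)

  SpanOf-least : ∀ {ℓ n} {V : Vec Carrier n → Set} → IsSubspace V → (w : Fin ℓ → Vec Carrier n) →
                 (∀ i → V (w i)) → SpanOf w ⊆ V
  SpanOf-least V-sub w w∈V x (a , refl) = lincomb∈ V-sub w w∈V a

  Span-least : ∀ {n} {V S : Vec Carrier n → Set} → IsSubspace V → S ⊆ V → Span S ⊆ V
  Span-least V-sub S⊆V x (ℓ , a , w , w∈S , refl) = lincomb∈ V-sub w (λ i → S⊆V _ (w∈S i)) a

  S⊆Span : ∀ {n} {S : Vec Carrier n → Set} → S ⊆ Span S
  S⊆Span x x∈S = 1 , (λ _ → 1#) , (λ _ → x) , (λ _ → x∈S) ,
    lookup-ext (λ j → sym (trans (lookup∘tabulate _ j) (trans (+-identityʳ _) (*-identityˡ _))))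

  IsSubspace-resp : ∀ {n} {V W : Vec Carrier n → Set} → IsSubspace V → V ⊆ W → W ⊆ V → IsSubspace W
  IsSubspace-resp V-sub V⊆W W⊆V = record
    { zero-mem = V⊆W _ (IsSubspace.zero-mem V-sub)
    ; +-mem    = λ x y x∈W y∈W → V⊆W _ (IsSubspace.+-mem V-sub x y (W⊆V x x∈W) (W⊆V y y∈W))
    ; ·-mem    = λ a x x∈W → V⊆W _ (IsSubspace.·-mem V-sub a x (W⊆V x x∈W))
    }

  LinIndep⇒injective : ∀ {ℓ n} {w : Fin ℓ → Vec Carrier n} → LinIndep w →
                       ∀ a b → lincomb a w ≡ lincomb b w → a ≗ b
  LinIndep⇒injective {w = w} w-indep a b eq i = x∙y⁻¹≈ε⇒x≈y (a i) (b i) (w-indep a-b (begin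
    lincomb a-b w                                  ≡⟨ lincomb-+ a -b w ⟩
    lincomb a w +V lincomb -b w                    ≡⟨ cong (_+V lincomb -b w) eq ⟩
    lincomb b w +V lincomb -b w                    ≡⟨ lincomb-+ b -b w ⟨
    lincomb (λ i → b i + - b i) w                  ≡⟨ lincomb-cong w (λ i → -‿inverseʳ (b i)) ⟩
    lincomb (λ _ → 0#) w                           ≡⟨ lincomb-zero w ⟩
    zeroV                                          ∎) i)
    where
    -b a-b : Fin _ → Carrier
    -b i = - b i
    a-b i = a i + - b i

  LinIndep-tail : ∀ {ℓ n} (w : Fin (suc ℓ) → Vec Carrier n) → LinIndep w → LinIndep (λ i → w (suc i))
  LinIndep-tail w w-indep a eq i = w-indep a′ (trans (lincomb-headZero a′ w refl) eq) (suc i)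
    where
    a′ : Fin (suc _) → Carrier
    a′ zero    = 0#
    a′ (suc i) = a i

  LinIndep-suffix : ∀ {r n} t (w : Fin (t ℕ.+ r) → Vec Carrier n) → LinIndep w →
                    LinIndep (λ i → w (t ↑ʳ i))
  LinIndep-suffix zero    w w-indep = w-indep
  LinIndep-suffix (suc t) w w-indep = LinIndep-suffix t (λ i → w (suc i)) (LinIndep-tail w w-indep)

  independentSubfamily : ∀ {n d} {V : Vec Carrier n → Set} → HasDim V d → ∀ r → r ℕ.≤ d →
                         Σ (Fin r → Vec Carrier n) λ v → LinIndep v × (∀ i → V (v i))
  independentSubfamily {d = d} (w , w∈V , w-indep , _) r r≤d with d ℕ.∸ r | ℕₚ.m∸n+n≡m r≤d
  ... | t | refl = (λ i → w (t ↑ʳ i)) , LinIndep-suffix t w w-indep , (λ i → w∈V (t ↑ʳ i))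

  ·-comm : ∀ {n} (x y : Vec Carrier n) → x · y ≡ y · x
  ·-comm x y = ∑-cong (λ j → *-comm (lookup x j) (lookup y j))

  ·-lincombʳ : ∀ {ℓ n} (x : Vec Carrier n) (a : Fin ℓ → Carrier) (w : Fin ℓ → Vec Carrier n) →
               x · lincomb a w ≡ ∑ (λ i → a i * (x · w i))
  ·-lincombʳ x a w = begin
    ∑ (λ j → x′ j * lookup (lincomb a w) j)
      ≡⟨ ∑-cong (λ j → cong (x′ j *_) (lookup-lincomb a w j)) ⟩
    ∑ (λ j → x′ j * ∑ (λ i → a i * w′ i j))
      ≡⟨ ∑-cong (λ j → *-distribˡ-∑ (x′ j) (λ i → a i * w′ i j)) ⟩
    ∑ (λ j → ∑ (λ i → x′ j * (a i * w′ i j)))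
      ≡⟨ ∑-swap (λ j i → x′ j * (a i * w′ i j)) ⟩
    ∑ (λ i → ∑ (λ j → x′ j * (a i * w′ i j)))
      ≡⟨ ∑-cong (λ i → ∑-cong (λ j → *-leftComm (x′ j) (a i) _)) ⟩
    ∑ (λ i → ∑ (λ j → a i * (x′ j * w′ i j)))
      ≡⟨ ∑-cong (λ i → *-distribˡ-∑ (a i) (λ j → x′ j * w′ i j)) ⟨
    ∑ (λ i → a i * (x · w i)) ∎
    where
    x′ = lookup x
    w′ = λ i → lookup (w i)

  ·-lincombˡ : ∀ {ℓ n} (a : Fin ℓ → Carrier) (w : Fin ℓ → Vec Carrier n) (y : Vec Carrier n) →
               lincomb a w · y ≡ ∑ (λ i → a i * (w i · y))
  ·-lincombˡ a w y = trans (·-comm (lincomb a w) y)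
    (trans (·-lincombʳ y a w) (∑-cong (λ i → cong (a i *_) (·-comm y (w i)))))

  ·-zeroʳ : ∀ {n} (x : Vec Carrier n) → x · zeroV ≡ 0#
  ·-zeroʳ {n} x = trans
    (∑-cong λ j → trans (cong (lookup x j *_) (lookup∘tabulate _ j)) (zeroʳ _))
    (∑-zero n)

  ·-+ʳ : ∀ {n} (x y z : Vec Carrier n) → x · (y +V z) ≡ x · y + x · z
  ·-+ʳ x y z = trans
    (∑-cong λ j → trans (cong (lookup x j *_) (lookup∘tabulate _ j)) (distribˡ (lookup x j) _ _))
    (∑-+ (λ j → lookup x j * lookup y j) (λ j → lookup x j * lookup z j))

  ·-*ʳ : ∀ {n} (x : Vec Carrier n) c y → x · (c ·V y) ≡ c * (x · y)
  ·-*ʳ x c y = trans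
    (∑-cong λ j → trans (cong (lookup x j *_) (lookup∘tabulate _ j)) (*-leftComm (lookup x j) c _))
    (sym (*-distribˡ-∑ c (λ j → lookup x j * lookup y j)))

  ⊥-isSubspace : ∀ {n} (X : Vec Carrier n → Set) → IsSubspace (X ⊥)
  ⊥-isSubspace X = record
    { zero-mem = λ x _ → ·-zeroʳ x
    ; +-mem    = λ y z y⊥X z⊥X x x∈X →
        trans (·-+ʳ x y z) (trans (cong₂ _+_ (y⊥X x x∈X) (z⊥X x x∈X)) (+-identityˡ 0#))
    ; ·-mem    = λ c y y⊥X x x∈X → trans (·-*ʳ x c y) (trans (cong (c *_) (y⊥X x x∈X)) (zeroʳ c))
    }

  ⊆⊥⊥ : ∀ {n} (X : Vec Carrier n → Set) → X ⊆ ((X ⊥) ⊥)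
  ⊆⊥⊥ X x x∈X z z⊥X = trans (·-comm z x) (z⊥X x x∈X)

  unit : ∀ {n} → Fin n → Vec Carrier n
  unit i = tabulate (δ i)

  ·-unit : ∀ {n} (x : Vec Carrier n) t → x · unit t ≡ lookup x t
  ·-unit x t = trans (∑-cong λ j → cong (lookup x j *_) (trans (lookup∘tabulate _ j) (δ-sym t j)))
                     (∑-δʳ (lookup x) t)

  lincomb-unit : ∀ {n} (x : Vec Carrier n) → lincomb (lookup x) unit ≡ x
  lincomb-unit x = lookup-ext λ t → trans (lookup-lincomb (lookup x) unit t)
    (trans (∑-cong (λ i → cong (lookup x i *_) (lookup∘tabulate _ t))) (∑-δʳ (lookup x) t))

funToFin-cong : ∀ {m n} {f g : Fin m → Fin n} → f ≗ g → Fin.funToFin f ≡ Fin.funToFin g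
funToFin-cong {zero}  _   = refl
funToFin-cong {suc m} f≗g = cong₂ Fin.combine (f≗g zero) (funToFin-cong (λ i → f≗g (suc i)))

Exhaustible : Set → Set₁
Exhaustible A = ∀ {P : A → Set} → U.Decidable P → Dec (∃ P)

Exhaustible-surjection : ∀ {A B : Set} (f : A → B) (g : B → A) → (∀ y → f (g y) ≡ y) →
                         Exhaustible A → Exhaustible B
Exhaustible-surjection f g f∘g≗id A-exh {P} P? with A-exh (λ x → P? (f x))
... | yes (x , p) = yes (f x , p)
... | no ¬p       = no λ { (y , p) → ¬p (g y , subst P (sym (f∘g≗id y)) p) }

Exhaustible-Vec : ∀ {A : Set} → Exhaustible A → ∀ n → Exhaustible (Vec A n)
Exhaustible-Vec A-exh zero    P? = Dec.map′ ([] ,_) (λ { ([] , p) → p }) (P? [])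
Exhaustible-Vec A-exh (suc n) P? = Dec.map′
  (λ { (x , xs , p) → x ∷ xs , p }) (λ { (x ∷ xs , p) → x , xs , p })
  (A-exh (λ x → Exhaustible-Vec A-exh n (λ xs → P? (x ∷ xs))))

Exhaustible⇒all? : ∀ {A : Set} → Exhaustible A → {P : A → Set} → U.Decidable P → Dec (∀ x → P x)
Exhaustible⇒all? A-exh P? = Dec.map′
  (λ ¬∃¬P x → decidable-stable (P? x) (λ ¬Px → ¬∃¬P (x , ¬Px)))
  (λ ∀P (x , ¬Px) → ¬Px (∀P x))
  (¬? (A-exh (λ x → ¬? (P? x))))

module FiniteField (F : Field) {N : ℕ} (F↔Fin : Field.Carrier F ↔ Fin N) where
  open Field F
  open LinAlg F
  open LinAlgProperties F
  open Inverse F↔Fin using (to; from; strictlyInverseˡ; strictlyInverseʳ)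
  open ≡-Reasoning

  to-injective : ∀ {x y} → to x ≡ to y → x ≡ y
  to-injective {x} {y} eq = trans (sym (strictlyInverseʳ x)) (trans (cong from eq) (strictlyInverseʳ y))

  _≟_ : DecidableEquality Carrier
  x ≟ y = Dec.map′ to-injective (cong to) (to x Fin.≟ to y)

  Vec-exhaustible : ∀ n → Exhaustible (Vec Carrier n)
  Vec-exhaustible = Exhaustible-Vec (Exhaustible-surjection from to strictlyInverseʳ FinP.any?)

  SpanOf? : ∀ {ℓ n} (w : Fin ℓ → Vec Carrier n) → U.Decidable (SpanOf w)
  SpanOf? {ℓ} w x = Dec.map′
    (λ { (a , eq) → lookup a , eq })
    (λ { (a , eq) → tabulate a , trans eq (lincomb-cong w (λ i → sym (lookup∘tabulate a i))) })
    (Vec-exhaustible ℓ (λ a → VecP.≡-dec _≟_ x (lincomb (lookup a) w)))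

  LinIndep? : ∀ {ℓ n} (w : Fin ℓ → Vec Carrier n) → Dec (LinIndep w)
  LinIndep? {ℓ} w = Dec.map′
    (λ h a eq i → trans (sym (lookup∘tabulate a i))
                        (h (tabulate a) (trans (lincomb-cong w (lookup∘tabulate a)) eq) i))
    (λ h a → h (lookup a))
    (Exhaustible⇒all? (Vec-exhaustible ℓ) (λ a →
      VecP.≡-dec _≟_ (lincomb (lookup a) w) zeroV →-dec FinP.all? (λ i → lookup a i ≟ 0#)))

  2≤N : 2 ℕ.≤ N
  2≤N = FinP.injective⇒≤ {f = λ i → to (bit i)} bits-distinct
    where
    bit : Fin 2 → Carrier
    bit zero    = 0#
    bit (suc _) = 1#
    bits-distinct : ∀ {i j} → to (bit i) ≡ to (bit j) → i ≡ j
    bits-distinct {zero}     {zero}     _  = refl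
    bits-distinct {zero}     {suc zero} eq = ⊥-elim (0≢1 (to-injective eq))
    bits-distinct {suc zero} {zero}     eq = ⊥-elim (0≢1 (sym (to-injective eq)))
    bits-distinct {suc zero} {suc zero} _  = refl

  -- Coordinates with respect to u inject F^ℓ into F^s, so N^ℓ ≤ N^s.
  LinIndep-≤ : ∀ {ℓ s n} (w : Fin ℓ → Vec Carrier n) (u : Fin s → Vec Carrier n) →
               LinIndep w → (∀ i → SpanOf u (w i)) → ℓ ℕ.≤ s
  LinIndep-≤ {ℓ} {s} w u w-indep w∈⟨u⟩ with ℓ ℕₚ.≤? s
  ... | yes ℓ≤s = ℓ≤s
  ... | no  ℓ≰s =
    ⊥-elim (ℕₚ.<⇒≱ (ℕₚ.^-monoʳ-< N 2≤N (ℕₚ.≰⇒> ℓ≰s)) (FinP.injective⇒≤ encode-injective))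
    where
    coordinates : (Fin ℓ → Carrier) → Fin s → Carrier
    coordinates a = proj₁ (SpanOf-least (SpanOf-isSubspace u) w w∈⟨u⟩ (lincomb a w) (a , refl))

    coordinates-injective : ∀ a b → coordinates a ≗ coordinates b → a ≗ b
    coordinates-injective a b eq = LinIndep⇒injective {w = w} w-indep a b (begin
      lincomb a w                ≡⟨ proj₂ (SpanOf-least (SpanOf-isSubspace u) w w∈⟨u⟩ _ (a , refl)) ⟩
      lincomb (coordinates a) u  ≡⟨ lincomb-cong u eq ⟩
      lincomb (coordinates b) u  ≡⟨ proj₂ (SpanOf-least (SpanOf-isSubspace u) w w∈⟨u⟩ _ (b , refl)) ⟨
      lincomb b w                ∎)

    digits : Fin (N ℕ.^ ℓ) → Fin ℓ → Fin N
    digits = Fin.finToFun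

    decode : Fin (N ℕ.^ ℓ) → Fin ℓ → Carrier
    decode t j = from (digits t j)

    encode : Fin (N ℕ.^ ℓ) → Fin (N ℕ.^ s)
    encode t = Fin.funToFin (λ i → to (coordinates (decode t) i))

    encode-injective : ∀ {t t′} → encode t ≡ encode t′ → t ≡ t′
    encode-injective {t} {t′} eq = begin
      t                        ≡⟨ FinP.funToFin-finToFin {ℓ} t ⟨
      Fin.funToFin (digits t)  ≡⟨ funToFin-cong digits-equal ⟩
      Fin.funToFin (digits t′) ≡⟨ FinP.funToFin-finToFin {ℓ} t′ ⟩
      t′                       ∎
      where
      coordinates-equal : coordinates (decode t) ≗ coordinates (decode t′)
      coordinates-equal i = to-injective (begin
        to (coordinates (decode t) i)           ≡⟨ FinP.finToFun-funToFin _ i ⟨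
        Fin.finToFun (encode t) i               ≡⟨ cong (λ c → Fin.finToFun c i) eq ⟩
        Fin.finToFun (encode t′) i              ≡⟨ FinP.finToFun-funToFin _ i ⟩
        to (coordinates (decode t′) i)          ∎)
      digits-equal : digits t ≗ digits t′
      digits-equal j = trans (sym (strictlyInverseˡ _)) (trans
        (cong to (coordinates-injective (decode t) (decode t′) coordinates-equal j))
        (strictlyInverseˡ _))

  LinIndep⇒≤n : ∀ {ℓ n} (w : Fin ℓ → Vec Carrier n) → LinIndep w → ℓ ℕ.≤ n
  LinIndep⇒≤n w w-indep = LinIndep-≤ w unit w-indep (λ i → lookup (w i) , sym (lincomb-unit (w i)))

  HasDim-unique : ∀ {n} {V : Vec Carrier n → Set} {d d′} → HasDim V d → HasDim V d′ → d ≡ d′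
  HasDim-unique (w , w∈V , w-indep , w-spans) (w′ , w′∈V , w′-indep , w′-spans) = ℕₚ.≤-antisym
    (LinIndep-≤ w w′ w-indep (λ i → w′-spans _ (w∈V i)))
    (LinIndep-≤ w′ w w′-indep (λ i → w-spans _ (w′∈V i)))

  head∈SpanOf-tail : ∀ {ℓ n} (a : Fin (suc ℓ) → Carrier) (w : Fin (suc ℓ) → Vec Carrier n) →
                     lincomb a w ≡ zeroV → ¬ a zero ≡ 0# → SpanOf (λ i → w (suc i)) (w zero)
  head∈SpanOf-tail a w a·w≡0 a₀≢0 = (λ i → - b * aₛ i) , lookup-ext λ j → begin
    lookup (w zero) j                    ≡⟨ *-identityˡ _ ⟨
    1# * lookup (w zero) j               ≡⟨ cong (_* lookup (w zero) j) (trans (sym a₀b≡1) (*-comm _ b)) ⟩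
    (b * a zero) * lookup (w zero) j     ≡⟨ *-assoc b (a zero) _ ⟩
    b * (a zero * lookup (w zero) j)     ≡⟨ cong (b *_) (+-inverseˡ-unique _ _ (head+tail≡0 j)) ⟩
    b * - lookup L j                     ≡⟨ -‿distribʳ-* b _ ⟨
    - (b * lookup L j)                   ≡⟨ -‿distribˡ-* b _ ⟩
    - b * lookup L j                     ≡⟨ lookup∘tabulate _ j ⟨
    lookup ((- b) ·V L) j                ≡⟨ cong (λ v → lookup v j) (lincomb-* (- b) aₛ wₛ) ⟨
    lookup (lincomb (λ i → - b * aₛ i) wₛ) j ∎
    where
    b = proj₁ (inverse (a zero) a₀≢0)
    a₀b≡1 = proj₂ (inverse (a zero) a₀≢0)
    aₛ = λ i → a (suc i)
    wₛ = λ i → w (suc i)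
    L = lincomb aₛ wₛ
    head+tail≡0 : ∀ j → a zero * lookup (w zero) j + lookup L j ≡ 0#
    head+tail≡0 j = begin
      a zero * lookup (w zero) j + lookup L j  ≡⟨ cong (_+ lookup L j) (lookup∘tabulate _ j) ⟨
      lookup (a zero ·V w zero) j + lookup L j ≡⟨ lookup∘tabulate _ j ⟨
      lookup ((a zero ·V w zero) +V L) j       ≡⟨ cong (λ v → lookup v j) (lincomb-suc a w) ⟨
      lookup (lincomb a w) j                   ≡⟨ cong (λ v → lookup v j) a·w≡0 ⟩
      lookup zeroV j                           ≡⟨ lookup∘tabulate _ j ⟩
      0#                                       ∎

  LinIndep-cons : ∀ {ℓ n} (w : Fin ℓ → Vec Carrier n) y → LinIndep w → ¬ SpanOf w y →
                  LinIndep (y ◂ w)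
  LinIndep-cons w y w-indep y∉⟨w⟩ a a·w≡0 with a zero ≟ 0#
  ... | no  a₀≢0 = ⊥-elim (y∉⟨w⟩ (head∈SpanOf-tail a (y ◂ w) a·w≡0 a₀≢0))
  ... | yes a₀≡0 = λ
    { zero    → a₀≡0
    ; (suc i) → w-indep (λ i → a (suc i)) (trans (sym (lincomb-headZero a (y ◂ w) a₀≡0)) a·w≡0) i
    }

  extendToBasis : ∀ {n p} {V : Vec Carrier n → Set} → U.Decidable V →
                  (w : Fin p → Vec Carrier n) → LinIndep w → (∀ i → V (w i)) →
                  Σ ℕ λ d → p ℕ.≤ d × HasDim V d
  extendToBasis {n} {p} {V} V? w = extend (suc n) w (ℕₚ.m≤n+m (suc n) p)
    where
    -- The fuel never runs out: an independent family in F^n has at most n members.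
    extend : ∀ fuel {p} (w : Fin p → Vec Carrier n) → n ℕ.< p ℕ.+ fuel →
             LinIndep w → (∀ i → V (w i)) → Σ ℕ λ d → p ℕ.≤ d × HasDim V d
    extend fuel {p} w n<p+fuel w-indep w∈V
      with Vec-exhaustible n (λ y → V? y ×-dec ¬? (SpanOf? w y))
    ... | no ∄y = p , ℕₚ.≤-refl , w , w∈V , w-indep ,
                  λ x x∈V → decidable-stable (SpanOf? w x) (λ x∉⟨w⟩ → ∄y (x , x∈V , x∉⟨w⟩))
    extend zero {p} w n<p+0 w-indep w∈V | yes _ =
      ⊥-elim (ℕₚ.<⇒≱ (subst (n ℕ.<_) (ℕₚ.+-identityʳ p) n<p+0) (LinIndep⇒≤n w w-indep))
    extend (suc fuel) {p} w n<p+fuel w-indep w∈V | yes (y , y∈V , y∉⟨w⟩) =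
      let d , 1+p≤d , V-dim = extend fuel (y ◂ w) (subst (n ℕ.<_) (ℕₚ.+-suc p fuel) n<p+fuel)
                                (LinIndep-cons w y w-indep y∉⟨w⟩) (λ { zero → y∈V ; (suc i) → w∈V i })
      in d , ℕₚ.≤-trans (ℕₚ.n≤1+n p) 1+p≤d , V-dim

  nonzero-coordinate : ∀ {n} (x : Vec Carrier n) → ¬ x ≡ zeroV → ∃ λ t → ¬ lookup x t ≡ 0#
  nonzero-coordinate x x≢0 with FinP.any? (λ t → ¬? (lookup x t ≟ 0#))
  ... | yes found = found
  ... | no  none  = ⊥-elim (x≢0 (lookup-ext λ t →
    trans (decidable-stable (lookup x t ≟ 0#) (λ xₜ≢0 → none (t , xₜ≢0))) (sym (lookup∘tabulate _ t))))

  -- u = v₀ − Σ cᵢ vᵢ₊₁ is nonzero by independence; g is orthogonal to the tail of v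
  -- and v₀ · g = u · e = uₜ ≠ 0.
  separatingVector : ∀ {p n} (v : Fin (suc p) → Vec Carrier n) → LinIndep v →
                     (f : Fin p → Vec Carrier n) → (∀ i j → v (suc j) · f i ≡ δ i j) →
                     Σ (Vec Carrier n) λ f₀ → v zero · f₀ ≡ 1# × (∀ j → v (suc j) · f₀ ≡ 0#)
  separatingVector v v-indep f f-dual = b ·V g , v₀·f₀≡1 , λ j →
    trans (·-*ʳ (v (suc j)) b g) (trans (cong (b *_) (vₛ·g≡0 j)) (zeroʳ b))
    where
    c : Fin _ → Carrier
    c i = v zero · f i
    a : Fin (suc _) → Carrier
    a = 1# ◂ (λ i → - c i)
    u = lincomb a v
    t = proj₁ (nonzero-coordinate u (λ u≡0 → 0≢1 (sym (v-indep a u≡0 zero))))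
    e = unit t
    d : Fin _ → Carrier
    d i = - (v (suc i) · e)
    g = e +V lincomb d f
    ·g : ∀ x → x · g ≡ x · e + ∑ (λ i → d i * (x · f i))
    ·g x = trans (·-+ʳ x e (lincomb d f)) (cong (x · e +_) (·-lincombʳ x d f))
    vₛ·g≡0 : ∀ j → v (suc j) · g ≡ 0#
    vₛ·g≡0 j = begin
      v (suc j) · g                                      ≡⟨ ·g (v (suc j)) ⟩
      v (suc j) · e + ∑ (λ i → d i * (v (suc j) · f i))
        ≡⟨ cong (v (suc j) · e +_) (∑-cong (λ i → cong (d i *_) (f-dual i j))) ⟩
      v (suc j) · e + ∑ (λ i → d i * δ i j)              ≡⟨ cong (v (suc j) · e +_) (∑-δʳ d j) ⟩
      v (suc j) · e + d j                                ≡⟨ -‿inverseʳ _ ⟩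
      0#                                                 ∎
    v₀·g≡uₜ : v zero · g ≡ lookup u t
    v₀·g≡uₜ = begin
      v zero · g                                            ≡⟨ ·g (v zero) ⟩
      v zero · e + ∑ (λ i → d i * c i)
        ≡⟨ cong₂ _+_ (*-identityˡ _) (∑-cong swap-sign) ⟨
      1# * (v zero · e) + ∑ (λ i → - c i * (v (suc i) · e)) ≡⟨ ·-lincombˡ a v e ⟨
      u · e                                                 ≡⟨ ·-unit u t ⟩
      lookup u t                                            ∎
      where
      swap-sign : ∀ i → - c i * (v (suc i) · e) ≡ d i * c i
      swap-sign i = trans (sym (-‿distribˡ-* _ _)) (trans (-‿distribʳ-* _ _) (*-comm (c i) (d i)))
    v₀·g≢0 : ¬ v zero · g ≡ 0#
    v₀·g≢0 v₀·g≡0 = proj₂ (nonzero-coordinate u _) (trans (sym v₀·g≡uₜ) v₀·g≡0)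
    b = proj₁ (inverse (v zero · g) v₀·g≢0)
    v₀·f₀≡1 : v zero · (b ·V g) ≡ 1#
    v₀·f₀≡1 = trans (·-*ʳ (v zero) b g) (trans (*-comm b _) (proj₂ (inverse (v zero · g) v₀·g≢0)))

  dualFamily : ∀ {p n} (v : Fin p → Vec Carrier n) → LinIndep v →
               Σ (Fin p → Vec Carrier n) λ f → ∀ i j → v j · f i ≡ δ i j
  dualFamily {zero}  v _       = (λ ()) , λ ()
  dualFamily {suc p} v v-indep = f₀ ◂ f , duality
    where
    tail-dual = dualFamily (λ i → v (suc i)) (LinIndep-tail v v-indep)
    f′ = proj₁ tail-dual
    f′-dual = proj₂ tail-dual
    separating = separatingVector v v-indep f′ f′-dual
    f₀ = proj₁ separating
    v₀·f₀≡1 = proj₁ (proj₂ separating)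
    vₛ·f₀≡0 = proj₂ (proj₂ separating)
    c : Fin p → Carrier
    c i = v zero · f′ i
    f : Fin p → Vec Carrier _
    f i = f′ i +V ((- c i) ·V f₀)
    ·f : ∀ x i → x · f i ≡ x · f′ i + - c i * (x · f₀)
    ·f x i = trans (·-+ʳ x (f′ i) ((- c i) ·V f₀)) (cong (x · f′ i +_) (·-*ʳ x (- c i) f₀))
    duality : ∀ i j → v j · (f₀ ◂ f) i ≡ δ i j
    duality zero    zero    = v₀·f₀≡1
    duality zero    (suc j) = vₛ·f₀≡0 j
    duality (suc i) zero    = begin
      v zero · f i                 ≡⟨ ·f (v zero) i ⟩
      c i + - c i * (v zero · f₀)  ≡⟨ cong (λ x → c i + - c i * x) v₀·f₀≡1 ⟩
      c i + - c i * 1#             ≡⟨ cong (c i +_) (*-identityʳ (- c i)) ⟩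
      c i + - c i                  ≡⟨ -‿inverseʳ (c i) ⟩
      0#                           ∎
    duality (suc i) (suc j) = begin
      v (suc j) · f i                             ≡⟨ ·f (v (suc j)) i ⟩
      v (suc j) · f′ i + - c i * (v (suc j) · f₀)
        ≡⟨ cong₂ (λ x y → x + - c i * y) (f′-dual i j) (vₛ·f₀≡0 j) ⟩
      δ i j + - c i * 0#                          ≡⟨ cong (δ i j +_) (zeroʳ (- c i)) ⟩
      δ i j + 0#                                  ≡⟨ +-identityʳ (δ i j) ⟩
      δ i j                                       ∎

  ⊥⊥⊆ : ∀ {n e} {X : Vec Carrier n → Set} → IsSubspace X → HasDim X e → ((X ⊥) ⊥) ⊆ X
  ⊥⊥⊆ {e = e} {X} X-sub (w , w∈X , w-indep , w-spans) y y∈X⊥⊥ with SpanOf? w y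
  ... | yes y∈⟨w⟩ = SpanOf-least X-sub w w∈X y y∈⟨w⟩
  ... | no  y∉⟨w⟩ =
    ⊥-elim (0≢1 (trans (sym (y∈X⊥⊥ z z⊥X)) (trans (·-comm z y) (f-dual zero zero))))
    where
    dual = dualFamily (y ◂ w) (LinIndep-cons w y w-indep y∉⟨w⟩)
    f-dual = proj₂ dual
    z = proj₁ dual zero
    z⊥X : (X ⊥) z
    z⊥X x x∈X = begin
      x · z                         ≡⟨ cong (_· z) (proj₂ (w-spans x x∈X)) ⟩
      lincomb a w · z               ≡⟨ ·-lincombˡ a w z ⟩
      ∑ (λ i → a i * (w i · z))
        ≡⟨ ∑-cong (λ i → trans (cong (a i *_) (f-dual zero (suc i))) (zeroʳ (a i))) ⟩
      ∑ {e} (λ _ → 0#)              ≡⟨ ∑-zero e ⟩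
      0#                            ∎
      where a = proj₁ (w-spans x x∈X)

module ExtensionProperties {F K : Field} {m : ℕ} (E : Extension F K m) where
  private
    module F = Field F
    module K = Field K
    module LF = LinAlg F
    module LK = LinAlg K
    module PF = LinAlgProperties F
    module PK = LinAlgProperties K
  open Extension E
  open ≡-Reasoning

  embed : Vec F.Carrier m → K.Carrier
  embed a = LK.∑ (λ i → ι (lookup a i) K.* β i)

  ι-0 : ι F.0# ≡ K.0#
  ι-0 = PK.x+x≈x⇒x≈0 _ (trans (sym (ι-+ F.0# F.0#)) (cong ι (PF.+-identityˡ F.0#)))

  ι-∑ : ∀ {ℓ} (f : Fin ℓ → F.Carrier) → ι (LF.∑ f) ≡ LK.∑ (λ i → ι (f i))
  ι-∑ {zero}  f = ι-0
  ι-∑ {suc ℓ} f = trans (ι-+ (f zero) _) (cong (ι (f zero) K.+_) (ι-∑ (λ i → f (suc i))))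

  embed-zero : embed LF.zeroV ≡ K.0#
  embed-zero = trans (PK.∑-cong λ i → trans (cong (λ a → ι a K.* β i) (lookup∘tabulate _ i))
                                            (trans (cong (K._* β i) ι-0) (PK.zeroˡ (β i))))
                     (PK.∑-zero m)

  embed-+ : ∀ a b → embed (a LF.+V b) ≡ embed a K.+ embed b
  embed-+ a b = trans
    (PK.∑-cong λ i → trans (cong (λ c → ι c K.* β i) (lookup∘tabulate _ i))
                           (trans (cong (K._* β i) (ι-+ (lookup a i) (lookup b i))) (PK.distribʳ (β i) _ _)))
    (PK.∑-+ (λ i → ι (lookup a i) K.* β i) (λ i → ι (lookup b i) K.* β i))

  embed-lincomb : ∀ {ℓ} (c : Fin ℓ → F.Carrier) (w : Fin ℓ → Vec F.Carrier m) →
                  embed (LF.lincomb c w) ≡ LK.∑ (λ j → ι (c j) K.* embed (w j))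
  embed-lincomb c w = begin
    LK.∑ (λ i → ι (lookup (LF.lincomb c w) i) K.* β i)
      ≡⟨ PK.∑-cong (λ i → cong (λ a → ι a K.* β i) (PF.lookup-lincomb c w i)) ⟩
    LK.∑ (λ i → ι (LF.∑ (λ j → c j F.* lookup (w j) i)) K.* β i)
      ≡⟨ PK.∑-cong (λ i → cong (K._* β i) (trans (ι-∑ (λ j → c j F.* lookup (w j) i))
                                                 (PK.∑-cong (λ j → ι-* (c j) _)))) ⟩
    LK.∑ (λ i → LK.∑ (λ j → ι (c j) K.* ιw j i) K.* β i)
      ≡⟨ PK.∑-cong (λ i → trans (PK.*-distribʳ-∑ (β i) (λ j → ι (c j) K.* ιw j i))
                                (PK.∑-cong (λ j → PK.*-assoc (ι (c j)) _ _))) ⟩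
    LK.∑ (λ i → LK.∑ (λ j → ι (c j) K.* (ιw j i K.* β i)))
      ≡⟨ PK.∑-swap (λ i j → ι (c j) K.* (ιw j i K.* β i)) ⟩
    LK.∑ (λ j → LK.∑ (λ i → ι (c j) K.* (ιw j i K.* β i)))
      ≡⟨ PK.∑-cong (λ j → PK.*-distribˡ-∑ (ι (c j)) (λ i → ιw j i K.* β i)) ⟨
    LK.∑ (λ j → ι (c j) K.* embed (w j)) ∎
    where
    ιw : _ → Fin m → K.Carrier
    ιw j i = ι (lookup (w j) i)

  coord-zero : coord K.0# ≡ LF.zeroV
  coord-zero = trans (cong coord (sym embed-zero)) (coord-unique LF.zeroV)

  coord-+ : ∀ x y → coord (x K.+ y) ≡ coord x LF.+V coord y
  coord-+ x y = begin
    coord (x K.+ y)                            ≡⟨ cong coord (cong₂ K._+_ (coord-expand x) (coord-expand y)) ⟨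
    coord (embed (coord x) K.+ embed (coord y)) ≡⟨ cong coord (embed-+ (coord x) (coord y)) ⟨
    coord (embed (coord x LF.+V coord y))      ≡⟨ coord-unique _ ⟩
    coord x LF.+V coord y                      ∎

  coord-* : ∀ a x → coord (a K.* x) ≡ LF.lincomb (lookup (coord x)) (λ j → coord (a K.* β j))
  coord-* a x = trans (cong coord a*x≡embed) (coord-unique _)
    where
    x′ = lookup (coord x)
    a*x≡embed : a K.* x ≡ embed (LF.lincomb x′ (λ j → coord (a K.* β j)))
    a*x≡embed = begin
      a K.* x                                          ≡⟨ cong (a K.*_) (coord-expand x) ⟨
      a K.* LK.∑ (λ j → ι (x′ j) K.* β j)              ≡⟨ PK.*-distribˡ-∑ a (λ j → ι (x′ j) K.* β j) ⟩
      LK.∑ (λ j → a K.* (ι (x′ j) K.* β j))            ≡⟨ PK.∑-cong (λ j → PK.*-leftComm a _ (β j)) ⟩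
      LK.∑ (λ j → ι (x′ j) K.* (a K.* β j))
        ≡⟨ PK.∑-cong (λ j → cong (ι (x′ j) K.*_) (coord-expand (a K.* β j))) ⟨
      LK.∑ (λ j → ι (x′ j) K.* embed (coord (a K.* β j)))
        ≡⟨ embed-lincomb x′ (λ j → coord (a K.* β j)) ⟨
      embed (LF.lincomb x′ (λ j → coord (a K.* β j))) ∎

  K↔Fin : ∀ {q} → F.Carrier ↔ Fin q → K.Carrier ↔ Fin (q ℕ.^ m)
  K↔Fin {q} F↔Fin = mk↔ₛ′ toK fromK toK∘fromK fromK∘toK
    where
    open Inverse F↔Fin using (to; from; strictlyInverseˡ; strictlyInverseʳ)
    toK : K.Carrier → Fin (q ℕ.^ m)
    toK x = Fin.funToFin (λ i → to (lookup (coord x) i))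
    digits : Fin (q ℕ.^ m) → Fin m → Fin q
    digits = Fin.finToFun
    decode : Fin (q ℕ.^ m) → Vec F.Carrier m
    decode t = tabulate (λ i → from (digits t i))
    fromK : Fin (q ℕ.^ m) → K.Carrier
    fromK t = embed (decode t)
    toK∘fromK : ∀ t → toK (fromK t) ≡ t
    toK∘fromK t = begin
      toK (fromK t)
        ≡⟨ funToFin-cong (λ i → cong (λ a → to (lookup a i)) (coord-unique (decode t))) ⟩
      Fin.funToFin (λ i → to (lookup (decode t) i))
        ≡⟨ funToFin-cong (λ i → trans (cong to (lookup∘tabulate _ i)) (strictlyInverseˡ (digits t i))) ⟩
      Fin.funToFin (digits t)
        ≡⟨ FinP.funToFin-finToFin {m} t ⟩
      t ∎
    fromK∘toK : ∀ x → fromK (toK x) ≡ x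
    fromK∘toK x = begin
      fromK (toK x)       ≡⟨ cong embed (tabulate-cong (λ i →
                               trans (cong from (FinP.finToFun-funToFin (λ i → to (lookup (coord x) i)) i))
                                     (strictlyInverseʳ (lookup (coord x) i)))) ⟩
      embed (tabulate (lookup (coord x))) ≡⟨ cong embed (tabulate∘lookup (coord x)) ⟩
      embed (coord x)     ≡⟨ coord-expand x ⟩
      x                   ∎

module RowSupport {F K : Field} {m : ℕ} (E : Extension F K m) {n : ℕ}
                  (C : Vec (Field.Carrier K) n → Set) (k : ℕ) where
  private
    module F = Field F
    module K = Field K
    module LF = LinAlg F
    module LK = LinAlg K
    module PF = LinAlgProperties F
  open Extension E
  open ExtensionProperties E
  open GabidulinCode E C k
  open ≡-Reasoning

  row-zero : ∀ j → row LK.zeroV j ≡ LF.zeroV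
  row-zero j = tabulate-cong λ t → begin
    lookup (coord (lookup LK.zeroV t)) j ≡⟨ cong (λ x → lookup (coord x) j) (lookup∘tabulate _ t) ⟩
    lookup (coord K.0#) j                ≡⟨ cong (λ a → lookup a j) coord-zero ⟩
    lookup LF.zeroV j                    ≡⟨ lookup∘tabulate _ j ⟩
    F.0#                                 ∎

  row-+ : ∀ c d j → row (c LK.+V d) j ≡ row c j LF.+V row d j
  row-+ c d j = tabulate-cong λ t → begin
    lookup (coord (lookup (c LK.+V d) t)) j
      ≡⟨ cong (λ x → lookup (coord x) j) (lookup∘tabulate _ t) ⟩
    lookup (coord (lookup c t K.+ lookup d t)) j           ≡⟨ cong (λ a → lookup a j) (coord-+ _ _) ⟩
    lookup (coord (lookup c t) LF.+V coord (lookup d t)) j ≡⟨ lookup∘tabulate _ j ⟩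
    lookup (coord (lookup c t)) j F.+ lookup (coord (lookup d t)) j
      ≡⟨ cong₂ F._+_ (lookup∘tabulate _ t) (lookup∘tabulate _ t) ⟨
    lookup (row c j) t F.+ lookup (row d j) t              ∎

  row-* : ∀ a c j → row (a LK.·V c) j ≡ LF.lincomb (λ j′ → lookup (coord (a K.* β j′)) j) (row c)
  row-* a c j = tabulate-cong λ t → begin
    lookup (coord (lookup (a LK.·V c) t)) j  ≡⟨ cong (λ x → lookup (coord x) j) (lookup∘tabulate _ t) ⟩
    lookup (coord (a K.* lookup c t)) j      ≡⟨ cong (λ v → lookup v j) (coord-* a (lookup c t)) ⟩
    lookup (LF.lincomb (lookup (coord (lookup c t))) (λ j′ → coord (a K.* β j′))) j
      ≡⟨ PF.lookup-lincomb (lookup (coord (lookup c t))) (λ j′ → coord (a K.* β j′)) j ⟩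
    LF.∑ (λ j′ → lookup (coord (lookup c t)) j′ F.* lookup (coord (a K.* β j′)) j)
      ≡⟨ PF.∑-cong (λ j′ → trans (cong (lookup (coord (a K.* β j′)) j F.*_)
                                        (lookup∘tabulate (λ t → lookup (coord (lookup c t)) j′) t))
                                 (PF.*-comm _ _)) ⟨
    LF.∑ (λ j′ → lookup (coord (a K.* β j′)) j F.* lookup (row c j′) t) ∎

  RowsIn : (FVec → Set) → KVec → Set
  RowsIn X c = ∀ j → X (row c j)

  RowsIn-isSubspace : ∀ {X} → LF.IsSubspace X → LK.IsSubspace (RowsIn X)
  RowsIn-isSubspace {X} X-sub = record
    { zero-mem = λ j → subst X (sym (row-zero j)) (LF.IsSubspace.zero-mem X-sub)
    ; +-mem    = λ c d c∈ d∈ j → subst X (sym (row-+ c d j)) (LF.IsSubspace.+-mem X-sub _ _ (c∈ j) (d∈ j))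
    ; ·-mem    = λ a c c∈ j → subst X (sym (row-* a c j)) (PF.lincomb∈ X-sub (row c) c∈ _)
    }

  row∈Rsupp : ∀ c j → Rsupp c (row c j)
  row∈Rsupp c j = PF.S⊆Span {S = λ x → ∃[ i ] (x ≡ row c i)} (row c j) (j , refl)

  Rsupp⊆⇒RowsIn : ∀ {X} c → Rsupp c LF.⊆ X → RowsIn X c
  Rsupp⊆⇒RowsIn c Rsupp⊆X j = Rsupp⊆X _ (row∈Rsupp c j)

  RowsIn⇒Rsupp⊆ : ∀ {X} → LF.IsSubspace X → ∀ c → RowsIn X c → Rsupp c LF.⊆ X
  RowsIn⇒Rsupp⊆ X-sub c rows∈X =
    PF.Span-least {S = λ x → ∃[ i ] (x ≡ row c i)} X-sub λ { x (j , refl) → rows∈X j }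

  Sub-Full⊥-dim : LK.HasDim (Sub (LF.Full LF.⊥)) 0
  Sub-Full⊥-dim = (λ ()) , (λ ()) , (λ _ _ ()) , λ c c∈Sub → (λ ()) , c≡0 c c∈Sub
    where
    c≡0 : ∀ c → Sub (LF.Full LF.⊥) c → c ≡ LK.zeroV
    c≡0 c (_ , Rsupp⊆Full⊥) = lookup-ext λ t → begin
      lookup c t                  ≡⟨ coord-expand (lookup c t) ⟨
      embed (coord (lookup c t))  ≡⟨ cong embed (lookup-ext {x = coord (lookup c t)} {y = LF.zeroV}
                                       (λ j → trans (entry j t) (sym (lookup∘tabulate _ j)))) ⟩
      embed LF.zeroV              ≡⟨ embed-zero ⟩
      K.0#                        ≡⟨ lookup∘tabulate _ t ⟨
      lookup LK.zeroV t           ∎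
      where
      entry : ∀ j t → lookup (coord (lookup c t)) j ≡ F.0#
      entry j t = begin
        lookup (coord (lookup c t)) j  ≡⟨ lookup∘tabulate _ t ⟨
        lookup (row c j) t             ≡⟨ PF.·-unit (row c j) t ⟨
        row c j LF.· PF.unit t         ≡⟨ PF.·-comm (row c j) (PF.unit t) ⟩
        PF.unit t LF.· row c j         ≡⟨ Rsupp⊆⇒RowsIn c Rsupp⊆Full⊥ j (PF.unit t) _ ⟩
        F.0#                           ∎

leastBelow : ∀ {P : ℕ → Set} → U.Decidable P → ∀ b →
             (∀ e → e ℕ.< b → ¬ P e) ⊎ ∃ (IsLeast P)
leastBelow P? zero = inj₁ (λ _ ())
leastBelow P? (suc b) with leastBelow P? b | P? b
... | inj₂ found | _      = inj₂ found
... | inj₁ none  | yes Pb = inj₂ (b , Pb , λ e Pe → ℕₚ.≮⇒≥ (λ e<b → none e e<b Pe))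
... | inj₁ none  | no ¬Pb = inj₁ λ e e<1+b →
  [ none e , (λ { refl → ¬Pb }) ]′ (ℕₚ.m<1+n⇒m<n∨m≡n e<1+b)

least : ∀ {P : ℕ → Set} → U.Decidable P → ∀ {e} → P e → ∃ (IsLeast P)
least P? {e} Pe =
  [ (λ none → ⊥-elim (none e (ℕₚ.n<1+n e) Pe)) , (λ found → found) ]′ (leastBelow P? (suc e))

dualNullity-identity : ∀ (e k c z : ℤ) → e ℤ.- (e ℤ.+ (k ℤ.- c) ℤ.- (k ℤ.- z)) ≡ c ℤ.- z
dualNullity-identity = solve-∀

module GeneralizedWeights {F K : Field} {q m : ℕ} (F↔Fin : Field.Carrier F ↔ Fin q)
                          (E : Extension F K m) {n : ℕ} (C : Vec (Field.Carrier K) n → Set)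
                          (C-sub : LinAlg.IsSubspace K C) {k : ℕ} (C-dim : LinAlg.HasDim K C k)
                          (r : ℕ) where
  private
    module LF = LinAlg F
    module LK = LinAlg K
    module PF = LinAlgProperties F
    module PK = LinAlgProperties K
    module FF = FiniteField F F↔Fin
    module FK = FiniteField K (ExtensionProperties.K↔Fin E F↔Fin)
  open GabidulinCode E C k
  open RowSupport E C k

  DualNullity≤dimSub : ∀ {X η} → DualNullity X η →
                  ∃ λ c → LK.HasDim (Sub ((X LF.⊥) LF.⊥)) c × η ℤ.≤ ℤ.+ c
  DualNullity≤dimSub (_ , _ , X-dim ,
                 (dx , _ , _ , X-dim′ , (c₁ , c₁-dim , refl) , (c₂ , _ , refl) , refl) , refl)
    rewrite FF.HasDim-unique X-dim X-dim′ =
    c₁ , c₁-dim , subst (ℤ._≤ ℤ.+ c₁)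
      (sym (trans (dualNullity-identity (ℤ.+ dx) (ℤ.+ k) (ℤ.+ c₁) (ℤ.+ c₂))
                  (ℤₚ.m-n≡m⊖n c₁ c₂)))
      (ℤₚ.m⊖n≤m c₁ c₂)

  DualNullity-dimSub : ∀ {X e c} → LF.HasDim X e → LK.HasDim (Sub ((X LF.⊥) LF.⊥)) c →
                   DualNullity X (ℤ.+ c)
  DualNullity-dimSub {e = e} {c} X-dim c-dim =
    e , _ , X-dim , (e , _ , _ , X-dim , (c , c-dim , refl) , (0 , Sub-Full⊥-dim , refl) , refl) ,
    sym (trans (dualNullity-identity (ℤ.+ e) (ℤ.+ k) (ℤ.+ c) (ℤ.+ 0)) (ℤₚ.+-identityʳ (ℤ.+ c)))

  C? : U.Decidable C
  C? c = Dec.map′ (PK.SpanOf-least C-sub basis basis∈C c) (basis-spans c) (FK.SpanOf? basis c)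
    where
    basis = proj₁ C-dim
    basis∈C = proj₁ (proj₂ C-dim)
    basis-spans = proj₂ (proj₂ (proj₂ C-dim))

  Sub⊥⊥⇒RowsIn-basis : ∀ {X e} → LF.IsSubspace X → (X-dim : LF.HasDim X e) →
                       ∀ c → Sub ((X LF.⊥) LF.⊥) c → RowsIn (PF.SpanOf (proj₁ X-dim)) c
  Sub⊥⊥⇒RowsIn-basis X-sub X-dim c (_ , Rsupp⊆X⊥⊥) j =
    proj₂ (proj₂ (proj₂ X-dim)) _ (FF.⊥⊥⊆ X-sub X-dim _ (Rsupp⊆⇒RowsIn c Rsupp⊆X⊥⊥ j))

  Sub⊥⊥? : ∀ {X e} → LF.IsSubspace X → LF.HasDim X e → U.Decidable (Sub ((X LF.⊥) LF.⊥))
  Sub⊥⊥? {X} X-sub X-dim c =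
    Dec.map′ fromRows (λ c∈ → proj₁ c∈ , Sub⊥⊥⇒RowsIn-basis X-sub X-dim c c∈)
    (C? c ×-dec FinP.all? (λ j → FF.SpanOf? b (row c j)))
    where
    b = proj₁ X-dim
    fromRows : C c × RowsIn (PF.SpanOf b) c → Sub ((X LF.⊥) LF.⊥) c
    fromRows (c∈C , rows∈⟨b⟩) = c∈C , RowsIn⇒Rsupp⊆ (PF.⊥-isSubspace (X LF.⊥)) c
      (λ j → PF.⊆⊥⊥ X _ (PF.SpanOf-least X-sub b (proj₁ (proj₂ X-dim)) _ (rows∈⟨b⟩ j)))

  SupportSpannedBy : ℕ → Set
  SupportSpannedBy e =
    Σ (Vec KVec r) λ v → (∀ i → C (lookup v i)) × LK.LinIndep (lookup v) ×
    Σ (Vec FVec e) λ u → ∀ i j → PF.SpanOf (lookup u) (row (lookup v i) j)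

  SupportSpannedBy? : U.Decidable SupportSpannedBy
  SupportSpannedBy? e = Exhaustible-Vec (FK.Vec-exhaustible n) r λ v →
    FinP.all? (λ i → C? (lookup v i)) ×-dec FK.LinIndep? (lookup v) ×-dec
    Exhaustible-Vec (FF.Vec-exhaustible n) e λ u →
    FinP.all? λ i → FinP.all? λ j → FF.SpanOf? (lookup u) (row (lookup v i) j)

  supportSpannedBy : ∀ {e} (v : Fin r → KVec) → (∀ i → C (v i)) → LK.LinIndep v →
                     (u : Fin e → FVec) → (∀ i j → PF.SpanOf u (row (v i) j)) → SupportSpannedBy e
  supportSpannedBy v v∈C v-indep u rows∈⟨u⟩ =
    tabulate v , (λ i → subst C (sym (lookup∘tabulate v i)) (v∈C i)) ,
    (λ a eq → v-indep a (trans (PK.lincomb-congʳ a (λ i → sym (lookup∘tabulate v i))) eq)) ,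
    tabulate u , λ i j → subst (λ c → PF.SpanOf (lookup (tabulate u)) (row c j))
                               (sym (lookup∘tabulate v i)) (retabulate (rows∈⟨u⟩ i j))
    where
    retabulate : ∀ {x} → PF.SpanOf u x → PF.SpanOf (lookup (tabulate u)) x
    retabulate (a , eq) = a , trans eq (PF.lincomb-congʳ a (λ i → sym (lookup∘tabulate u i)))

  module SubcodeSpannedBy (v : Fin r → KVec) (v∈C : ∀ i → C (v i)) (v-indep : LK.LinIndep v) where
    D : KVec → Set
    D = PK.SpanOf v

    Generators : FVec → Set
    Generators x = ∃[ d ] (D d × Rsupp d x)

    RsuppSub-least : ∀ {Z} → LF.IsSubspace Z → (∀ i j → Z (row (v i) j)) → RsuppSub D LF.⊆ Z
    RsuppSub-least Z-sub rows∈Z = PF.Span-least {S = Generators} Z-sub λ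
      { x (_ , (a , refl) , x∈Rsupp) →
          RowsIn⇒Rsupp⊆ Z-sub (LK.lincomb a v)
                        (PK.lincomb∈ (RowsIn-isSubspace Z-sub) v rows∈Z a) x x∈Rsupp }

    rowIndex : Fin (r ℕ.* m) → Fin r × Fin m
    rowIndex = Fin.remQuot m

    rowOf : Fin (r ℕ.* m) → FVec
    rowOf t = row (v (proj₁ (rowIndex t))) (proj₂ (rowIndex t))

    SpanOf-rowOf⊆RsuppSub : PF.SpanOf rowOf LF.⊆ RsuppSub D
    SpanOf-rowOf⊆RsuppSub x (a , eq) = r ℕ.* m , a , rowOf , rowOf∈Generators , eq
      where
      rowOf∈Generators : ∀ t → Generators (rowOf t)
      rowOf∈Generators t =
        v (proj₁ (rowIndex t)) , PK.w∈SpanOf v _ , row∈Rsupp (v (proj₁ (rowIndex t))) _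

    RsuppSub⊆SpanOf-rowOf : RsuppSub D LF.⊆ PF.SpanOf rowOf
    RsuppSub⊆SpanOf-rowOf = RsuppSub-least (PF.SpanOf-isSubspace rowOf) λ i j →
      subst (PF.SpanOf rowOf) (cong (λ (i , j) → row (v i) j) (FinP.remQuot-combine {r} {m} i j))
            (PF.w∈SpanOf rowOf (Fin.combine i j))

    support-isSubspace : LF.IsSubspace (RsuppSub D)
    support-isSubspace =
      PF.IsSubspace-resp (PF.SpanOf-isSubspace rowOf) SpanOf-rowOf⊆RsuppSub RsuppSub⊆SpanOf-rowOf

    RsuppSub? : U.Decidable (RsuppSub D)
    RsuppSub? x = Dec.map′ (SpanOf-rowOf⊆RsuppSub x) (RsuppSub⊆SpanOf-rowOf x) (FF.SpanOf? rowOf x)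

    support-dim : Σ ℕ (LF.HasDim (RsuppSub D))
    support-dim =
      let d , _ , d-dim = FF.extendToBasis {p = 0} RsuppSub? (λ ()) (λ _ _ ()) (λ ()) in d , d-dim

    e′ : ℕ
    e′ = proj₁ support-dim

    e′-minimal : ∀ {e} (u : Fin e → FVec) → (∀ i j → PF.SpanOf u (row (v i) j)) → e′ ℕ.≤ e
    e′-minimal u rows∈⟨u⟩ = FF.LinIndep-≤ b u b-indep
      (λ i → RsuppSub-least (PF.SpanOf-isSubspace u) rows∈⟨u⟩ _ (b∈RsuppSub i))
      where
      b = proj₁ (proj₂ support-dim)
      b∈RsuppSub = proj₁ (proj₂ (proj₂ support-dim))
      b-indep = proj₁ (proj₂ (proj₂ (proj₂ support-dim)))

    grw : GRW r e′
    grw = D , PK.SpanOf-isSubspace v , PK.SpanOf-least C-sub v v∈C ,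
          (v , PK.w∈SpanOf v , v-indep , λ _ x∈D → x∈D) , proj₂ support-dim

    null : NullSet r e′
    null = X , support-isSubspace , X-dim , ℤ.+ c , DualNullity-dimSub X-dim c-dim , ℤ.+≤+ r≤c
      where
      X = RsuppSub D
      X-dim = proj₂ support-dim
      v∈Sub⊥⊥ : ∀ i → Sub ((X LF.⊥) LF.⊥) (v i)
      v∈Sub⊥⊥ i = v∈C i , λ x x∈Rsupp →
        PF.⊆⊥⊥ X x (PF.S⊆Span {S = Generators} x (v i , PK.w∈SpanOf v i , x∈Rsupp))
      extended = FK.extendToBasis (Sub⊥⊥? support-isSubspace X-dim) v v-indep v∈Sub⊥⊥
      c = proj₁ extended
      r≤c = proj₁ (proj₂ extended)
      c-dim = proj₂ (proj₂ extended)

  GRW⇒SupportSpannedBy : ∀ {e} → GRW r e → SupportSpannedBy e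
  GRW⇒SupportSpannedBy (D , _ , D⊆C , (v , v∈D , v-indep , _) , (u , _ , _ , u-spans)) =
    supportSpannedBy v (λ i → D⊆C _ (v∈D i)) v-indep u λ i j → u-spans _
      (PF.S⊆Span {S = λ x → ∃[ d ] (D d × Rsupp d x)} _ (v i , v∈D i , row∈Rsupp (v i) j))

  NullSet⇒SupportSpannedBy : ∀ {e} → NullSet r e → SupportSpannedBy e
  NullSet⇒SupportSpannedBy (X , X-sub , X-dim , η , η-nullity , r≤η) =
    let c , c-dim , η≤c = DualNullity≤dimSub η-nullity
        v , v-indep , v∈Sub = PK.independentSubfamily c-dim r (ℤₚ.drop‿+≤+ (ℤₚ.≤-trans r≤η η≤c))
    in supportSpannedBy v (λ i → proj₁ (v∈Sub i)) v-indep (proj₁ X-dim)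
         (λ i → Sub⊥⊥⇒RowsIn-basis X-sub X-dim (v i) (v∈Sub i))

  SupportSpannedBy-n : r ℕ.≤ k → SupportSpannedBy n
  SupportSpannedBy-n r≤k =
    let v , v-indep , v∈C = PK.independentSubfamily C-dim r r≤k
    in supportSpannedBy v v∈C v-indep PF.unit (λ i j → lookup (row (v i) j) , sym (PF.lincomb-unit _))

  SupportSpannedBy⇒realised : ∀ {e} → SupportSpannedBy e →
                              ∃ λ e′ → e′ ℕ.≤ e × GRW r e′ × NullSet r e′
  SupportSpannedBy⇒realised (v , v∈C , v-indep , u , rows∈⟨u⟩) =
    e′ , e′-minimal (lookup u) rows∈⟨u⟩ , grw , null
    where open SubcodeSpannedBy (lookup v) v∈C v-indep

proposition3p10 : (F K : Field) (q m : ℕ) → (Field.Carrier F ↔ Fin q)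
    → (E : Extension F K m) (n : ℕ) (C : Vec (Field.Carrier K) n → Set)
    → LinAlg.IsSubspace K C → (k : ℕ) → LinAlg.HasDim K C k
    → (r : ℕ) → 1 ≤ r → r ≤ k
    → ∃[ d ] (IsLeast (GabidulinCode.GRW E C k r) d × IsLeast (GabidulinCode.NullSet E C k r) d)
proposition3p10 F K q m F↔Fin E n C C-sub k C-dim r _ r≤k =
  let e₀ , e₀-supported , e₀-least = least SupportSpannedBy? (SupportSpannedBy-n r≤k)
      d , d≤e₀ , grw , null        = SupportSpannedBy⇒realised e₀-supported
  in d , (grw  , λ e grw-e  → ℕₚ.≤-trans d≤e₀ (e₀-least e (GRW⇒SupportSpannedBy grw-e)))
       , (null , λ e null-e → ℕₚ.≤-trans d≤e₀ (e₀-least e (NullSet⇒SupportSpannedBy null-e)))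
  where open GeneralizedWeights F↔Fin E C C-sub C-dim r
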